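{- Let $\preceq$ be an entrenchment relation satisfying Left Disjunction. Then $N(\preceq)=\mathrel{|\!\sim_\preceq}$, i.e. for all $\alpha,\beta\in\mathcal{L}$, $\neg\beta\preceq\neg\alpha$ iff $\alpha\mathrel{|\!\sim_\preceq}\beta$.
   Context: $\mathcal{L}$ is the set of formulas of a propositional language closed under $\lor,\land,\neg,\to$. $\vdash\subseteq 2^{\mathcal{L}}\times\mathcal{L}$ is a fixed consequence relation including classical propositional logic, compact, satisfying the deduction theorem and disjunction in premises; $\alpha\vdash\beta$ means $\{\alpha\}\vdash\beta$; $\mathrm{Cn}(X)=\{\beta:X\vdash\beta\}$, $\mathrm{Cn}(X,\alpha)=\mathrm{Cn}(X\cup\{\alpha\})$. An entrenchment relation is a binary relation $\preceq$ on $\mathcal{L}$ such that for all $\alpha,\beta,\gamma$: $\alpha\preceq\alpha$; $\alpha\vdash\beta$ and $\beta\preceq\gamma$ imply $\alpha\preceq\gamma$; if $\alpha\vdash\beta$ and $\beta\vdash\alpha$ then $\gamma\preceq\alpha$ iff $\gamma\preceq\beta$. Left Disjunction: $\beta\preceq\alpha$ and $\gamma\preceq\alpha$ imply $\beta\lor\gamma\preceq\alpha$. $N(\preceq)$ is the relation with $\alpha\mathrel{N(\preceq)}\beta$ iff $\neg\beta\preceq\neg\alpha$. Maxiconsistent inference: $\mathrm{Coh}(\alpha)=\{\beta:\beta\not\preceq\neg\alpha\}$; $\mathcal{B}(\alpha)$ = deductively closed $U$ with $U\subseteq\mathrm{Coh}(\alpha)$; $\mathcal{B}_{\max}(\alpha)$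 = those $U\in\mathcal{B}(\alpha)$ with no deductively closed $U'\supsetneq U$ in $\mathcal{B}(\alpha)$; $E(\alpha)=\bigcap\{\mathrm{Cn}(U,\alpha):U\in\mathcal{B}_{\max}(\alpha)\}$ (empty intersection $=\mathcal{L}$); $\alpha\mathrel{|\!\sim_\preceq}\beta$ iff $\beta\in E(\alpha)$. -}

module Defs where

open import Level using (0ℓ)
open import Data.Bool using (Bool; true; false; _∧_; _∨_; not)
open import Data.List using (List)
open import Data.List.Relation.Unary.All using (All)
open import Data.Product using (Σ; ∃; _×_; _,_)
open import Data.Sum using (_⊎_)
open import Relation.Binary.PropositionalEquality using (_≡_)
open import Relation.Nullary using (¬_; Dec)
open import Relation.Unary using (Pred; _⊆_; _∪_)
open import Function.Bundles using (_⇔_)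

infixr 6 _∧ᶠ_
infixr 5 _∨ᶠ_
infixr 4 _⇒ᶠ_

data Formula (A : Set) : Set where
  atom  : A → Formula A
  ¬ᶠ_   : Formula A → Formula A
  _∨ᶠ_  : Formula A → Formula A → Formula A
  _∧ᶠ_  : Formula A → Formula A → Formula A
  _⇒ᶠ_  : Formula A → Formula A → Formula A

⟦_⟧ : {A : Set} → Formula A → (A → Bool) → Bool
⟦ atom a ⟧ v = v a
⟦ ¬ᶠ φ ⟧ v = not (⟦ φ ⟧ v)
⟦ φ ∨ᶠ ψ ⟧ v = ⟦ φ ⟧ v ∨ ⟦ ψ ⟧ v
⟦ φ ∧ᶠ ψ ⟧ v = ⟦ φ ⟧ v ∧ ⟦ ψ ⟧ v
⟦ φ ⇒ᶠ ψ ⟧ v = not (⟦ φ ⟧ v) ∨ ⟦ ψ ⟧ v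

FSet : Set → Set₁
FSet A = Pred (Formula A) 0ℓ

_⊨_ : {A : Set} → FSet A → Formula A → Set
_⊨_ {A} X β = (v : A → Bool) → (∀ γ → X γ → ⟦ γ ⟧ v ≡ true) → ⟦ β ⟧ v ≡ true

｛_｝ : {A : Set} → Formula A → FSet A
｛ α ｝ = λ x → x ≡ α

fromList : {A : Set} → List (Formula A) → FSet A
fromList Γ = λ x → Data.List.Relation.Unary.Any.Any (x ≡_) Γ
  where import Data.List.Relation.Unary.Any

record ConsequenceRelation (A : Set) : Set₁ where
  field
    _⊢_ : FSet A → Formula A → Set
    -- includes classical propositional logic (hence also inclusion X ⊆ Cn X)
    supraclassical : ∀ {X β} → X ⊨ β → X ⊢ β
    monotone : ∀ {X Y : FSet A} {β} → X ⊆ Y → X ⊢ β → Y ⊢ β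
    cut : ∀ {X Y : FSet A} {β} → (∀ γ → Y γ → X ⊢ γ) → Y ⊢ β → X ⊢ β
    compact : ∀ {X β} → X ⊢ β →
              Σ (List (Formula A)) (λ Γ → All X Γ × (fromList Γ ⊢ β))
    deduction : ∀ {X α β} → ((X ∪ ｛ α ｝) ⊢ β) ⇔ (X ⊢ (α ⇒ᶠ β))
    disjPremises : ∀ {X α β γ} → (X ∪ ｛ α ｝) ⊢ γ → (X ∪ ｛ β ｝) ⊢ γ →
                   (X ∪ ｛ α ∨ᶠ β ｝) ⊢ γ

module Logic {A : Set} (CR : ConsequenceRelation A) where
  open ConsequenceRelation CR public

  _⊢₁_ : Formula A → Formula A → Set
  α ⊢₁ β = ｛ α ｝ ⊢ β

  Cn : FSet A → FSet A
  Cn X β = X ⊢ β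

  Cn₂ : FSet A → Formula A → FSet A
  Cn₂ X α = Cn (X ∪ ｛ α ｝)

  DedClosed : FSet A → Set
  DedClosed U = ∀ β → U ⊢ β → U β

  record IsEntrenchment (_⪯_ : Formula A → Formula A → Set) : Set where
    field
      refl⪯   : ∀ α → α ⪯ α
      dominance : ∀ {α β γ} → α ⊢₁ β → β ⪯ γ → α ⪯ γ
      rightEquiv : ∀ {α β γ} → α ⊢₁ β → β ⊢₁ α → (γ ⪯ α) ⇔ (γ ⪯ β)

  LeftDisjunction : (Formula A → Formula A → Set) → Set
  LeftDisjunction _⪯_ = ∀ {α β γ} → β ⪯ α → γ ⪯ α → (β ∨ᶠ γ) ⪯ α

  N : (Formula A → Formula A → Set) → Formula A → Formula A → Set
  N _⪯_ α β = (¬ᶠ β) ⪯ (¬ᶠ α)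

  module Maxiconsistent (_⪯_ : Formula A → Formula A → Set) where
    Coh : Formula A → FSet A
    Coh α β = ¬ (β ⪯ (¬ᶠ α))

    𝓑 : Formula A → FSet A → Set
    𝓑 α U = DedClosed U × U ⊆ Coh α

    𝓑max : Formula A → FSet A → Set₁
    𝓑max α U = 𝓑 α U ×
      ¬ (Σ (FSet A) (λ U' → 𝓑 α U' × U ⊆ U' × ∃ (λ x → U' x × ¬ U x)))

    -- β ∈ E(α)  (intersection over 𝓑_max(α); empty intersection = L)
    E : Formula A → Formula A → Set₁
    E α β = (U : FSet A) → 𝓑max α U → Cn₂ U α β

    _|~_ : Formula A → Formula A → Set₁
    α |~ β = E α β

-- Classical metatheory used by the paper (excluded middle and Zorn's
-- lemma), made explicit since Agda is constructive.

Chain : {B : Set} → Pred (Pred B 0ℓ) 0ℓ → Set₁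
Chain C = ∀ V W → C V → C W → V ⊆ W ⊎ W ⊆ V

record ClassicalMetatheory : Set₂ where
  field
    lem₀ : (P : Set) → Dec P
    lem₁ : (P : Set₁) → Dec P
    zorn : {B : Set} (P : Pred (Pred B 0ℓ) 0ℓ) →
           ((C : Pred (Pred B 0ℓ) 0ℓ) → C ⊆ P → Chain C → Σ (Pred B 0ℓ) C →
              Σ (Pred B 0ℓ) (λ V → P V × (∀ W → C W → W ⊆ V))) →
           (X : Pred B 0ℓ) → P X →
           Σ (Pred B 0ℓ) (λ M → P M × X ⊆ M × (∀ M' → P M' → M ⊆ M' → M' ⊆ M))

{-# OPTIONS --safe #-}
module Submission where

-- (⇒) If ¬β ⪯ ¬α and U ∈ 𝓑max(α) does not contain α → β, then
-- Cn(U, α → β) is still coherent with α: any γ in it puts (α ∧ ¬β) ∨ γ in U,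
-- and γ ⪯ ¬α would give (α ∧ ¬β) ∨ γ ⪯ ¬α by Left Disjunction, since
-- α ∧ ¬β ⊢ ¬β ⪯ ¬α.  This contradicts maximality, so U, α ⊢ β.
-- (⇐) If ¬β ⋠ ¬α, then Cn(¬β) ∈ 𝓑(α); Zorn extends it to some M ∈ 𝓑max(α).
-- From M, α ⊢ β and ¬β ∈ M we get ¬α ∈ M, impossible because ¬α ⪯ ¬α.

open import Defs
open import Function.Bundles using (_⇔_; mk⇔; module Equivalence)
open import Level using (0ℓ)
open import Data.Bool using (true; false; _∧_; _∨_; not)
open import Data.List using (List; []; _∷_)
open import Data.List.Relation.Unary.All using (All; []; _∷_)
open import Data.List.Relation.Unary.Any using (here; there)
open import Data.Product using (Σ; ∃; _×_; _,_; proj₁; proj₂)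
open import Data.Sum using (inj₁; inj₂)
open import Relation.Binary.PropositionalEquality using (_≡_; refl)
open import Relation.Nullary.Decidable using (True; toWitness; fromWitness; decidable-stable)
open import Relation.Unary using (Pred; _⊆_; _∪_)

module ConsequenceProperties {A : Set} (CR : ConsequenceRelation A) where
  open Logic CR

  ∈⇒⊢ : ∀ {X : FSet A} {φ} → X φ → X ⊢ φ
  ∈⇒⊢ {φ = φ} x = supraclassical (λ v h → h φ x)

  Cn-dedClosed : ∀ X → DedClosed (Cn X)
  Cn-dedClosed X β = cut (λ _ d → d)

  ⊢-cut₁ : ∀ {X φ χ} → X ⊢ φ → φ ⊢₁ χ → X ⊢ χ
  ⊢-cut₁ dφ = cut (λ { _ refl → dφ })

  ⊢-cut₂ : ∀ {X φ ψ χ} → X ⊢ φ → X ⊢ ψ → (｛ φ ｝ ∪ ｛ ψ ｝) ⊢ χ → X ⊢ χ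
  ⊢-cut₂ dφ dψ = cut (λ { _ (inj₁ refl) → dφ ; _ (inj₂ refl) → dψ })

  ∧¬-⊢₁-¬ : ∀ α β → (α ∧ᶠ ¬ᶠ β) ⊢₁ (¬ᶠ β)
  ∧¬-⊢₁-¬ α β = supraclassical (λ v h → bool (⟦ α ⟧ v) (⟦ β ⟧ v) (h _ refl))
    where
    bool : ∀ a b → a ∧ not b ≡ true → not b ≡ true
    bool true  b h = h
    bool false b ()

  ⇒⇒-⊢₁-∧¬∨ : ∀ α β γ → ((α ⇒ᶠ β) ⇒ᶠ γ) ⊢₁ ((α ∧ᶠ ¬ᶠ β) ∨ᶠ γ)
  ⇒⇒-⊢₁-∧¬∨ α β γ =
    supraclassical (λ v h → bool (⟦ α ⟧ v) (⟦ β ⟧ v) (⟦ γ ⟧ v) (h _ refl))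
    where
    bool : ∀ a b c → not (not a ∨ b) ∨ c ≡ true → (a ∧ not b) ∨ c ≡ true
    bool true  false c h = refl
    bool true  true  c h = h
    bool false b     c h = h

  modusTollens : ∀ α β → (｛ α ⇒ᶠ β ｝ ∪ ｛ ¬ᶠ β ｝) ⊢ (¬ᶠ α)
  modusTollens α β =
    supraclassical (λ v h → bool (⟦ α ⟧ v) (⟦ β ⟧ v) (h _ (inj₁ refl)) (h _ (inj₂ refl)))
    where
    bool : ∀ a b → not a ∨ b ≡ true → not b ≡ true → not a ≡ true
    bool false b     _  _  = refl
    bool true  true  _  ()
    bool true  false () _

module MaximalExtension (cm : ClassicalMetatheory) {A : Set} (CR : ConsequenceRelation A)
    (_⪯_ : Formula A → Formula A → Set) where
  open ClassicalMetatheory cm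
  open Logic CR
  open Maxiconsistent _⪯_
  open ConsequenceProperties CR

  -- The union is decided by lem₁ so that it lands in Set rather than Set₁.
  ⋃ : Pred (FSet A) 0ℓ → FSet A
  ⋃ C x = True (lem₁ (∃ λ W → C W × W x))

  ⊆-⋃ : ∀ {C W} → C W → W ⊆ ⋃ C
  ⊆-⋃ {W = W} cW wx = fromWitness (W , cW , wx)

  ⋃-⊆ : ∀ {C} {Y : FSet A} → (∀ {W} → C W → W ⊆ Y) → ⋃ C ⊆ Y
  ⋃-⊆ C⊆Y x with toWitness x
  ... | W , cW , wx = C⊆Y cW wx

  chain-bounds-finite : ∀ {C} → Chain C → Σ (FSet A) C →
                        (Γ : List (Formula A)) → All (⋃ C) Γ →
                        ∃ λ W → C W × fromList Γ ⊆ W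
  chain-bounds-finite ch (W₀ , cW₀) [] [] = W₀ , cW₀ , λ ()
  chain-bounds-finite ch nonempty (x ∷ Γ) (ux ∷ uΓ)
    with toWitness ux | chain-bounds-finite ch nonempty Γ uΓ
  ... | W₁ , c₁ , w₁ | W₂ , c₂ , Γ⊆W₂ with ch W₁ W₂ c₁ c₂
  ... | inj₁ W₁⊆W₂ = W₂ , c₂ , λ { (here refl) → W₁⊆W₂ w₁ ; (there i) → Γ⊆W₂ i }
  ... | inj₂ W₂⊆W₁ = W₁ , c₁ , λ { (here refl) → w₁ ; (there i) → W₂⊆W₁ (Γ⊆W₂ i) }

  ⋃-dedClosed : ∀ {C} → (∀ {W} → C W → DedClosed W) → Chain C → Σ (FSet A) C →
                DedClosed (⋃ C)
  ⋃-dedClosed closed ch nonempty β d with compact d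
  ... | Γ , uΓ , dΓ with chain-bounds-finite ch nonempty Γ uΓ
  ... | W , cW , Γ⊆W = ⊆-⋃ cW (closed cW β (monotone Γ⊆W dΓ))

  𝓑-extends-to-𝓑max : ∀ {α X} → 𝓑 α X → ∃ λ M → 𝓑max α M × X ⊆ M
  𝓑-extends-to-𝓑max {α} {X} X∈𝓑 with zorn (𝓑 α) chainsBounded X X∈𝓑
    where
    chainsBounded : (C : Pred (FSet A) 0ℓ) → C ⊆ 𝓑 α → Chain C → Σ (FSet A) C →
                    ∃ λ V → 𝓑 α V × (∀ W → C W → W ⊆ V)
    chainsBounded C C⊆𝓑 ch nonempty =
      ⋃ C , (⋃-dedClosed (λ cW → proj₁ (C⊆𝓑 cW)) ch nonempty , ⋃-⊆ (λ cW → proj₂ (C⊆𝓑 cW))) ,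
      λ W cW → ⊆-⋃ cW
  ... | M , M∈𝓑 , X⊆M , maximal =
    M , (M∈𝓑 , λ { (U' , U'∈𝓑 , M⊆U' , x , U'x , ¬Mx) → ¬Mx (maximal U' U'∈𝓑 M⊆U' U'x) }) , X⊆M

  𝓑max-absorbs : ∀ {α U U'} → 𝓑max α U → 𝓑 α U' → U ⊆ U' → U' ⊆ U
  𝓑max-absorbs {U = U} {U'} (_ , noLarger) U'∈𝓑 U⊆U' {x} U'x =
    decidable-stable (lem₀ (U x)) (λ ¬Ux → noLarger (U' , U'∈𝓑 , U⊆U' , x , U'x , ¬Ux))

module Theorem12 (cm : ClassicalMetatheory) {A : Set} (CR : ConsequenceRelation A)
    (_⪯_ : Formula A → Formula A → Set)
    (ent : Logic.IsEntrenchment CR _⪯_) (leftDisj : Logic.LeftDisjunction CR _⪯_) where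
  open ClassicalMetatheory cm
  open Logic CR
  open IsEntrenchment ent
  open Maxiconsistent _⪯_
  open ConsequenceProperties CR
  open MaximalExtension cm CR _⪯_

  Cn-⇒-𝓑 : ∀ {α β U} → N _⪯_ α β → 𝓑 α U → 𝓑 α (Cn₂ U (α ⇒ᶠ β))
  Cn-⇒-𝓑 {α} {β} {U} ¬β⪯¬α (U-closed , U-coherent) =
    Cn-dedClosed _ , λ {γ} d γ⪯¬α →
      U-coherent (inU d) (leftDisj (dominance (∧¬-⊢₁-¬ α β) ¬β⪯¬α) γ⪯¬α)
    where
    inU : ∀ {γ} → Cn₂ U (α ⇒ᶠ β) γ → U ((α ∧ᶠ ¬ᶠ β) ∨ᶠ γ)
    inU {γ} d = U-closed _ (⊢-cut₁ (Equivalence.to deduction d) (⇒⇒-⊢₁-∧¬∨ α β γ))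

  N⇒|~ : ∀ α β → N _⪯_ α β → α |~ β
  N⇒|~ α β ¬β⪯¬α U U∈𝓑max@(U∈𝓑 , _) =
    Equivalence.from deduction (∈⇒⊢ (𝓑max-absorbs U∈𝓑max (Cn-⇒-𝓑 ¬β⪯¬α U∈𝓑)
                                       (λ u → ∈⇒⊢ (inj₁ u)) (∈⇒⊢ (inj₂ refl))))

  |~⇒N : ∀ α β → α |~ β → N _⪯_ α β
  |~⇒N α β α|~β = decidable-stable (lem₀ _) λ ¬β⋠¬α →
    let Cn¬β∈𝓑 : 𝓑 α (Cn ｛ ¬ᶠ β ｝)
        Cn¬β∈𝓑 = Cn-dedClosed _ , λ d γ⪯¬α → ¬β⋠¬α (dominance d γ⪯¬α)
        M , (M∈𝓑@(M-closed , M-coherent) , M-max) , Cn¬β⊆M = 𝓑-extends-to-𝓑max Cn¬β∈𝓑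
        M⊢α⇒β : M ⊢ (α ⇒ᶠ β)
        M⊢α⇒β = Equivalence.to deduction (α|~β M (M∈𝓑 , M-max))
        M⊢¬β : M ⊢ (¬ᶠ β)
        M⊢¬β = ∈⇒⊢ (Cn¬β⊆M (∈⇒⊢ refl))
    in M-coherent (M-closed _ (⊢-cut₂ M⊢α⇒β M⊢¬β (modusTollens α β))) (refl⪯ (¬ᶠ α))

mainTheorem12 : (cm : ClassicalMetatheory) {A : Set} (CR : ConsequenceRelation A)
                (_⪯_ : Formula A → Formula A → Set) →
                Logic.IsEntrenchment CR _⪯_ → Logic.LeftDisjunction CR _⪯_ →
                (α β : Formula A) →
                ((¬ᶠ β) ⪯ (¬ᶠ α)) ⇔ Logic.Maxiconsistent._|~_ CR _⪯_ α β
mainTheorem12 cm CR _⪯_ ent leftDisj α β = mk⇔ (N⇒|~ α β) (|~⇒N α β)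
  where open Theorem12 cm CR _⪯_ ent leftDisj
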